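{- Let $k\geq 2$ and $d\geq 1$ be integers such that $l:=\frac{d}{k-1}$ is an integer. Let $H_0,H_1,\ldots,H_l$ be pairwise vertex-disjoint graphs, where $H_0$ is a complete bipartite graph with bipartition $(U_1,U_2)$ and $|U_1|=|U_2|=d$, and for each $1\leq i\leq l$, $H_i$ is a complete graph of order $d+1$. Choose $l$ distinct vertices $u_1,\ldots,u_l\in U_1$ and, for each $1\leq i\leq l$, a vertex $v_i\in V(H_i)$. Let $G_{k,d}$ be the graph obtained from the disjoint union $H_0\cup H_1\cup\cdots\cup H_l$ by adding the edges $u_iv_i$ for $1\leq i\leq l$. Then $G_{k,d}$ has no $[2,k]$-ST.
   Context: All graphs are finite and simple. For a tree $T$ and an integer $i\geq 0$, $V_i(T)$ is the set of vertices of degree exactly $i$ in $T$. A spanning tree $T$ of a graph $G$ is called a $[2,k]$-ST of $G$ if $\bigcup_{2\leq i\leq k}V_i(T)=\emptyset$, i.e., $T$ has no vertex whose degree lies in $\{2,3,\ldots,k\}$. -}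

module Defs where

open import Data.Nat using (ℕ; suc; _+_; _*_; _≤_)
open import Data.Fin using (Fin; splitAt; remQuot)
open import Data.Bool using (Bool; true)
open import Data.List using (List; []; _∷_; _++_; [_]; length; filterᵇ; allFin)
open import Data.List.Relation.Unary.Linked using (Linked)
open import Data.List.Relation.Unary.Unique.Propositional using (Unique)
open import Data.Product using (_×_; Σ; ∃; ∃-syntax)
open import Data.Sum using (inj₁; inj₂)
open import Data.Unit using (⊤)
open import Data.Empty using (⊥)
open import Relation.Nullary using (¬_)
open import Relation.Binary.PropositionalEquality using (_≡_; _≢_)

module _ {n : ℕ} where

  Edge : (Fin n → Fin n → Bool) → Fin n → Fin n → Set
  Edge T x y = T x y ≡ true

  data Walk (T : Fin n → Fin n → Bool) : Fin n → Fin n → Set where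
    here : ∀ {x} → Walk T x x
    step : ∀ {x y z} → Edge T x y → Walk T y z → Walk T x z

  Connected : (Fin n → Fin n → Bool) → Set
  Connected T = ∀ x y → Walk T x y

  HasCycle : (Fin n → Fin n → Bool) → Set
  HasCycle T = Σ (Fin n) λ x₀ → Σ (List (Fin n)) λ xs →
      (2 ≤ length xs) × Unique (x₀ ∷ xs) × Linked (Edge T) (x₀ ∷ xs ++ [ x₀ ])

  Acyclic : (Fin n → Fin n → Bool) → Set
  Acyclic T = ¬ HasCycle T

  deg : (Fin n → Fin n → Bool) → Fin n → ℕ
  deg T v = length (filterᵇ (T v) (allFin n))

  record SpanningTree (Adj : Fin n → Fin n → Set) (T : Fin n → Fin n → Bool) : Set where
    field
      sym     : ∀ x y → T x y ≡ T y x
      subset  : ∀ x y → Edge T x y → Adj x y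
      conn    : Connected T
      acyclic : Acyclic T

  record TwoKST (k : ℕ) (Adj : Fin n → Fin n → Set) (T : Fin n → Fin n → Bool) : Set where
    field
      tree : SpanningTree Adj T
      noMid : ∀ v → ¬ (2 ≤ deg T v × deg T v ≤ k)

-- Vertex set Fin ((d + d) + l * suc d):
--   first d vertices  : U₁ (vertex i ∈ Fin d)
--   next  d vertices  : U₂
--   remaining blocks  : H_j (j ∈ Fin l), each with vertices Fin (suc d).
-- Parameters: u : Fin l → Fin d gives u_j ∈ U₁, v : Fin l → Fin (suc d)
-- gives v_j ∈ V(H_j).

data Vtx (d l : ℕ) : Set where
  U₁ : Fin d → Vtx d l
  U₂ : Fin d → Vtx d l
  H  : Fin l → Fin (suc d) → Vtx d l

classify : ∀ d l → Fin ((d + d) + l * suc d) → Vtx d l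
classify d l x with splitAt (d + d) x
... | inj₂ y with remQuot {l} (suc d) y
...   | (j Data.Product., z) = H j z
classify d l x | inj₁ y with splitAt d y
... | inj₁ i = U₁ i
... | inj₂ i = U₂ i

VAdj : ∀ {d l} → (Fin l → Fin d) → (Fin l → Fin (suc d)) → Vtx d l → Vtx d l → Set
VAdj u v (U₁ i) (U₂ j) = ⊤
VAdj u v (U₂ j) (U₁ i) = ⊤
VAdj u v (H j x) (H j' y) = j ≡ j' × x ≢ y
VAdj u v (U₁ i) (H j y) = u j ≡ i × v j ≡ y
VAdj u v (H j y) (U₁ i) = u j ≡ i × v j ≡ y
VAdj u v _ _ = ⊥

GAdj : ∀ d l → (Fin l → Fin d) → (Fin l → Fin (suc d)) →
       Fin ((d + d) + l * suc d) → Fin ((d + d) + l * suc d) → Set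
GAdj d l u v x y = VAdj u v (classify d l x) (classify d l y)

{-# OPTIONS --safe #-}
-- The edge u_i v_i is the only edge joining H_i to the rest of G_{k,d}, so every spanning tree T
-- contains it; likewise H_i ∪ {u_i} is joined to the rest only by edges from u_i to U₂, so T contains
-- one of them. Thus u_i has T-degree at least 2, hence at least k + 1, i.e. at least k T-neighbours
-- in U₂. The forest that T induces on {u_1, …, u_l} ∪ U₂ then has at least l k = l + d edges on
-- l + d vertices. That is impossible: deleting a vertex with at most one neighbour on the other side
-- keeps the edge count at least the vertex count, and once no such vertex is left one can walk
-- around a cycle.
module Submission where

open import Defs
open import Data.Nat using (ℕ; zero; suc; _+_; _*_; _∸_; _≤_; _<_; z≤n; s≤s; s≤s⁻¹; _≤?_)
open import Data.Nat.Properties hiding (_≟_)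
open import Data.Nat.Induction using (<-wellFounded)
open import Data.Nat.ListAction using (sum)
open import Data.Nat.ListAction.Properties using (sum-↭)
open import Data.Fin as Fin using (Fin; _↑ˡ_; _↑ʳ_; combine; splitAt; remQuot)
open import Data.Fin.Properties
  using (_≟_; splitAt-↑ˡ; splitAt-↑ʳ; splitAt⁻¹-↑ˡ; splitAt⁻¹-↑ʳ; remQuot-combine; combine-remQuot)
open import Data.Bool using (Bool; true; false)
open import Data.Bool.Properties using (T-≡)
open import Data.List using (List; []; _∷_; _++_; [_]; length; filterᵇ; map; allFin; tabulate)
open import Data.List.Properties using (++-assoc; length-++; length-filter; length-tabulate; map-cong)
open import Data.List.Membership.Propositional using (_∈_; find)
open import Data.List.Membership.Propositional.Properties
  using (∈-∃++; ∈-filter⁺; ∈-filter⁻; ∈-allFin; ∈-tabulate⁺; ∈-++⁻; ∈-++⁺ˡ; ∈-++⁺ʳ)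
open import Data.List.Relation.Binary.Subset.Propositional using (_⊆_)
open import Data.List.Relation.Binary.Permutation.Propositional using (_↭_; ↭⇒↭ₛ)
open import Data.List.Relation.Binary.Permutation.Propositional.Properties
  using (shift; ↭-length; ∈-resp-↭; filter-↭)
  renaming (map⁺ to map⁺-↭)
import Data.List.Relation.Binary.Permutation.Setoid.Properties as ↭ₛ
open import Data.List.Relation.Unary.All as All using (All; []; _∷_)
open import Data.List.Relation.Unary.All.Properties using (¬Any⇒All¬; ++⁻ˡ; tabulate⁺)
open import Data.List.Relation.Unary.AllPairs as AllPairs using ([]; _∷_)
open import Data.List.Relation.Unary.Any using (here; there; any?)
open import Data.List.Relation.Unary.Linked using (Linked; []; [-]; _∷_)
open import Data.List.Relation.Unary.Unique.Propositional using (Unique)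
import Data.List.Relation.Unary.Unique.Propositional.Properties as Uniqueₚ
open import Data.Product using (∃; ∃₂; _×_; _,_; proj₂; uncurry)
open import Data.Sum using (_⊎_; inj₁; inj₂)
open import Data.Empty using (⊥)
open import Function using (_∘_; case_of_; Equivalence)
open import Function.Definitions using (Injective)
open import Induction.WellFounded using (Acc; acc)
open import Algebra.Properties.CommutativeSemigroup +-commutativeSemigroup using (x∙yz≈y∙xz)
open import Relation.Nullary using (¬_; yes; no; contradiction)
open import Relation.Nullary.Decidable using (T?)
open import Relation.Unary using (Decidable)
open import Relation.Binary.Definitions using (DecidableEquality)
open import Relation.Binary.PropositionalEquality
  using (_≡_; _≢_; refl; sym; trans; cong; cong₂; subst; subst₂; setoid)

module _ {A : Set} where

  ∈⇒↭∷ : ∀ {x : A} {xs} → x ∈ xs → ∃ λ ys → xs ↭ x ∷ ys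
  ∈⇒↭∷ x∈xs with ys , zs , refl ← ∈-∃++ x∈xs = ys ++ zs , shift _ ys zs

  Unique-resp-↭ : ∀ {xs ys : List A} → xs ↭ ys → Unique xs → Unique ys
  Unique-resp-↭ xs↭ys = ↭ₛ.Unique-resp-↭ (setoid A) (↭⇒↭ₛ xs↭ys)

  Unique-⊆⇒length≤ : ∀ {xs ys : List A} → Unique xs → xs ⊆ ys → length xs ≤ length ys
  Unique-⊆⇒length≤ {[]} _ _ = z≤n
  Unique-⊆⇒length≤ {x ∷ xs} (x∉xs ∷ uxs) xs⊆ys with ys′ , ys↭ ← ∈⇒↭∷ (xs⊆ys (here refl)) =
    ≤-trans (s≤s (Unique-⊆⇒length≤ uxs xs⊆ys′)) (≤-reflexive (sym (↭-length ys↭)))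
    where
    xs⊆ys′ : xs ⊆ ys′
    xs⊆ys′ z∈xs with ∈-resp-↭ ys↭ (xs⊆ys (there z∈xs))
    ... | here z≡x    = contradiction (sym z≡x) (All.lookup x∉xs z∈xs)
    ... | there z∈ys′ = z∈ys′

  Unique⇒∃≢ : DecidableEquality A → ∀ {xs} → Unique xs → 2 ≤ length xs →
              ∀ z → ∃ λ y → y ∈ xs × y ≢ z
  Unique⇒∃≢ _≟_ {x ∷ y ∷ _} ((x≢y ∷ _) ∷ _) _ z with x ≟ z
  ... | no x≢z   = x , here refl , x≢z
  ... | yes refl = y , there (here refl) , x≢y ∘ sym
  Unique⇒∃≢ _ {_ ∷ []} _ (s≤s ()) _

  Unique-prefix : ∀ xs {y : A} {ys} → Unique (xs ++ y ∷ ys) → Unique (xs ++ [ y ])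
  Unique-prefix []       _          = [] ∷ []
  Unique-prefix (x ∷ xs) (x∉ ∷ uxs) =
    ++⁻ˡ (xs ++ [ _ ]) (subst (All _) (sym (++-assoc xs [ _ ] _)) x∉) ∷ Unique-prefix xs uxs

  Linked-prefix-∷ʳ : ∀ {R : A → A → Set} xs {y ys z} →
                     Linked R (xs ++ y ∷ ys) → R y z → Linked R ((xs ++ [ y ]) ++ [ z ])
  Linked-prefix-∷ʳ []           _         r = r ∷ [-]
  Linked-prefix-∷ʳ (_ ∷ [])     (e ∷ _)   r = e ∷ r ∷ [-]
  Linked-prefix-∷ʳ (_ ∷ x ∷ xs) (e ∷ es)  r = e ∷ Linked-prefix-∷ʳ (x ∷ xs) es r

module SimpleGraph {n : ℕ} (t : Fin n → Fin n → Bool)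
  (t-sym : ∀ x y → t x y ≡ t y x) (t-irrefl : ∀ x → ¬ Edge t x x) where

  open import Data.List.Membership.DecPropositional (_≟_ {n}) using (_∈?_)

  Edge-sym : ∀ {x y} → Edge t x y → Edge t y x
  Edge-sym {x} {y} = trans (t-sym y x)

  N[_]∩_ : Fin n → List (Fin n) → List (Fin n)
  N[ x ]∩ ys = filterᵇ (t x) ys

  ∈-N⁺ : ∀ {x y ys} → y ∈ ys → Edge t x y → y ∈ N[ x ]∩ ys
  ∈-N⁺ {x} y∈ys e = ∈-filter⁺ (T? ∘ t x) y∈ys (Equivalence.from T-≡ e)

  ∈-N⁻ : ∀ {x y ys} → y ∈ N[ x ]∩ ys → y ∈ ys × Edge t x y
  ∈-N⁻ {x} y∈ with y∈ys , ty ← ∈-filter⁻ (T? ∘ t x) y∈ = y∈ys , Equivalence.to T-≡ ty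

  |N∩|-∷ : ∀ {x y} ys → Edge t x y → length (N[ x ]∩ (y ∷ ys)) ≡ suc (length (N[ x ]∩ ys))
  |N∩|-∷ _ e rewrite e = refl

  Unique-N : ∀ {x ys} → Unique ys → Unique (N[ x ]∩ ys)
  Unique-N {x} = Uniqueₚ.filter⁺ (T? ∘ t x)

  deg≡|N∩| : ∀ {x ys} → Unique ys → (∀ {y} → Edge t x y → y ∈ ys) → deg t x ≡ length (N[ x ]∩ ys)
  deg≡|N∩| {x} {ys} uys nbrs = ≤-antisym
    (Unique-⊆⇒length≤ (Unique-N (Uniqueₚ.allFin⁺ n)) λ y∈ →
      let e = proj₂ (∈-N⁻ {ys = allFin n} y∈) in ∈-N⁺ (nbrs e) e)
    (Unique-⊆⇒length≤ (Unique-N uys) λ y∈ → ∈-N⁺ (∈-allFin _) (proj₂ (∈-N⁻ {ys = ys} y∈)))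

  Walk-crossing : (R : Fin n → Set) → Decidable R → ∀ {x y} → Walk t x y → ¬ R x → R y →
                  ∃₂ λ x′ y′ → ¬ R x′ × R y′ × Edge t x′ y′
  Walk-crossing R R? here              ¬Rx Ry = contradiction Ry ¬Rx
  Walk-crossing R R? (step {y = z} e w) ¬Rx Ry with R? z
  ... | yes Rz  = _ , _ , ¬Rx , Rz , e
  ... | no ¬Rz = Walk-crossing R R? w ¬Rz Ry

  closeCycle : ∀ {x r y} p {q} → Unique (x ∷ r ∷ p ++ y ∷ q) →
               Linked (Edge t) (x ∷ r ∷ p ++ y ∷ q) → Edge t y x → HasCycle t
  closeCycle {x} {r} {y} p u es e =
    x , r ∷ p ++ [ y ] , s≤s 1≤|p++[y]| , Unique-prefix (x ∷ r ∷ p) u , Linked-prefix-∷ʳ (x ∷ r ∷ p) es e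
    where
    1≤|p++[y]| : 1 ≤ length (p ++ [ y ])
    1≤|p++[y]| = subst (1 ≤_) (sym (length-++ p)) (m≤n+m 1 (length p))

  module _ (S : List (Fin n)) (branch : ∀ {x} → x ∈ S → ∀ z → ∃ λ y → y ∈ S × Edge t x y × y ≢ z) where

    -- A path is kept as the list x ∷ rest of its vertices, read from its growing end x.
    private
      previous : Fin n → List (Fin n) → Fin n
      previous x []      = x
      previous _ (r ∷ _) = r

      extend : ∀ f x rest → length S ≤ f + length rest → Unique (x ∷ rest) →
               Linked (Edge t) (x ∷ rest) → All (_∈ S) (x ∷ rest) → HasCycle t
      extend zero x rest bound u _ inS =
        contradiction (≤-trans (Unique-⊆⇒length≤ u (All.lookup inS)) bound) 1+n≰n
      extend (suc f) x rest bound u es inS@(x∈S ∷ _) with branch x∈S (previous x rest)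
      ... | y , y∈S , exy , y≢prev with y ∈? x ∷ rest
      ...   | yes (here refl)    = contradiction exy (t-irrefl x)
      ...   | yes (there y∈rest) with ∈-∃++ y∈rest
      ...     | []    , _ , refl = contradiction refl y≢prev
      ...     | _ ∷ p , _ , refl = closeCycle p u es (Edge-sym exy)
      extend (suc f) x rest bound u es inS | y , y∈S , exy , _ | no y∉path =
        extend f y (x ∷ rest) (subst (length S ≤_) (sym (+-suc f _)) bound)
               (¬Any⇒All¬ _ y∉path ∷ u) (Edge-sym exy ∷ es) (y∈S ∷ inS)

    minDegree≥2⇒HasCycle : ∀ {x} → x ∈ S → HasCycle t
    minDegree≥2⇒HasCycle {x} x∈S =
      extend (length S) x [] (≤-reflexive (sym (+-identityʳ _))) ([] ∷ []) [-] (x∈S ∷ [])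

  edges : List (Fin n) → List (Fin n) → ℕ
  edges As Ws = sum (map (λ a → length (N[ a ]∩ Ws)) As)

  edges-∷ʳ : ∀ As w Ws → edges As (w ∷ Ws) ≡ length (N[ w ]∩ As) + edges As Ws
  edges-∷ʳ []       _ _  = refl
  edges-∷ʳ (a ∷ As) w Ws rewrite edges-∷ʳ As w Ws | t-sym a w with t w a
  ... | true  = cong suc (x∙yz≈y∙xz (length (N[ a ]∩ Ws)) (length (N[ w ]∩ As)) (edges As Ws))
  ... | false = x∙yz≈y∙xz (length (N[ a ]∩ Ws)) (length (N[ w ]∩ As)) (edges As Ws)

  edges-≥ : ∀ {k As} Ws → All (λ a → k ≤ length (N[ a ]∩ Ws)) As → length As * k ≤ edges As Ws
  edges-≥ _  []         = z≤n
  edges-≥ Ws (k≤ ∷ k≤s) = +-mono-≤ k≤ (edges-≥ Ws k≤s)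

  Dense : List (Fin n) → List (Fin n) → Set
  Dense As Ws = length As + length Ws ≤ edges As Ws

  Dense-respˡ-↭ : ∀ {As As′ Ws} → As ↭ As′ → Dense As Ws → Dense As′ Ws
  Dense-respˡ-↭ {Ws = Ws} p = subst₂ _≤_ (cong (_+ length Ws) (↭-length p)) (sum-↭ (map⁺-↭ _ p))

  Dense-respʳ-↭ : ∀ {As Ws Ws′} → Ws ↭ Ws′ → Dense As Ws → Dense As Ws′
  Dense-respʳ-↭ {As} p = subst₂ _≤_ (cong (length As +_) (↭-length p))
    (cong sum (map-cong (λ a → ↭-length (filter-↭ (T? ∘ t a) p)) As))

  ¬Dense-[_] : ∀ a {Ws} → ¬ Dense [ a ] Ws
  ¬Dense-[ a ] {Ws} dense =
    1+n≰n (≤-trans dense (≤-trans (≤-reflexive (+-identityʳ _)) (length-filter (T? ∘ t a) Ws)))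

  Dense-peelˡ : ∀ {a As Ws} → length (N[ a ]∩ Ws) ≤ 1 → Dense (a ∷ As) Ws → Dense As Ws
  Dense-peelˡ leaf dense = s≤s⁻¹ (≤-trans dense (+-monoˡ-≤ _ leaf))

  Dense-peelʳ : ∀ {As w Ws} → length (N[ w ]∩ As) ≤ 1 → Dense As (w ∷ Ws) → Dense As Ws
  Dense-peelʳ {As} {w} {Ws} leaf dense = s≤s⁻¹ (begin
    suc (length As + length Ws)         ≡⟨ +-suc (length As) (length Ws) ⟨
    length As + suc (length Ws)         ≤⟨ dense ⟩
    edges As (w ∷ Ws)                   ≡⟨ edges-∷ʳ As w Ws ⟩
    length (N[ w ]∩ As) + edges As Ws   ≤⟨ +-monoˡ-≤ _ leaf ⟩
    suc (edges As Ws)                   ∎)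
    where open ≤-Reasoning

  ∃-other-neighbour : ∀ {x ys} → Unique ys → 2 ≤ length (N[ x ]∩ ys) →
                      ∀ z → ∃ λ y → y ∈ ys × Edge t x y × y ≢ z
  ∃-other-neighbour {ys = ys} uys two z
    with y , y∈N , y≢z ← Unique⇒∃≢ _≟_ (Unique-N uys) two z
    with y∈ys , e ← ∈-N⁻ {ys = ys} y∈N = y , y∈ys , e , y≢z

  bipartite-minDegree≥2⇒HasCycle : ∀ {x As Ws} → Unique As → Unique Ws → x ∈ As →
    All (λ a → 2 ≤ length (N[ a ]∩ Ws)) As → All (λ w → 2 ≤ length (N[ w ]∩ As)) Ws → HasCycle t
  bipartite-minDegree≥2⇒HasCycle {As = As} {Ws} uAs uWs x∈As degAs degWs =
    minDegree≥2⇒HasCycle (As ++ Ws) branch (∈-++⁺ˡ x∈As)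
    where
    branch : ∀ {x} → x ∈ As ++ Ws → ∀ z → ∃ λ y → y ∈ As ++ Ws × Edge t x y × y ≢ z
    branch x∈ z with ∈-++⁻ As x∈
    ... | inj₁ a∈As with y , y∈Ws , e , y≢z ← ∃-other-neighbour uWs (All.lookup degAs a∈As) z =
      y , ∈-++⁺ʳ As y∈Ws , e , y≢z
    ... | inj₂ w∈Ws with y , y∈As , e , y≢z ← ∃-other-neighbour uAs (All.lookup degWs w∈Ws) z =
      y , ∈-++⁺ˡ y∈As , e , y≢z

  Dense⇒HasCycle : ∀ {As Ws} → Unique As → Unique Ws → 0 < length As → Dense As Ws → HasCycle t
  Dense⇒HasCycle = go (<-wellFounded _)
    where
    go : ∀ {As Ws} → Acc _<_ (length As + length Ws) →
         Unique As → Unique Ws → 0 < length As → Dense As Ws → HasCycle t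
    go {As} {Ws} (acc smaller) uAs uWs nonempty dense
      with any? (λ a → length (N[ a ]∩ Ws) ≤? 1) As
    ... | yes leafA with a , a∈As , leaf ← find leafA | ∈⇒↭∷ a∈As
    ...   | []      , p = contradiction (Dense-respˡ-↭ {Ws = Ws} p dense) (¬Dense-[ a ] {Ws})
    ...   | b ∷ As′ , p =
      go (smaller (≤-reflexive (cong (_+ length Ws) (sym (↭-length p)))))
         (AllPairs.tail (Unique-resp-↭ p uAs)) uWs (s≤s z≤n)
         (Dense-peelˡ {a} {b ∷ As′} {Ws} leaf (Dense-respˡ-↭ {Ws = Ws} p dense))
    go {As} {Ws} (acc smaller) uAs uWs nonempty dense | no noLeafA
      with any? (λ w → length (N[ w ]∩ As) ≤? 1) Ws
    ... | yes leafW with w , w∈Ws , leaf ← find leafW | ∈⇒↭∷ w∈Ws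
    ...   | Ws′ , p =
      go (smaller (≤-reflexive (trans (sym (+-suc _ _)) (cong (length As +_) (sym (↭-length p))))))
         uAs (AllPairs.tail (Unique-resp-↭ p uWs)) nonempty
         (Dense-peelʳ {As} {w} {Ws′} leaf (Dense-respʳ-↭ {As} p dense))
    go {_ ∷ _} _ uAs uWs _ _ | no noLeafA | no noLeafW =
      bipartite-minDegree≥2⇒HasCycle uAs uWs (here refl)
        (All.map ≰⇒> (¬Any⇒All¬ _ noLeafA)) (All.map ≰⇒> (¬Any⇒All¬ _ noLeafW))

module Vertices (d l : ℕ) where

  toFin : Vtx d l → Fin ((d + d) + l * suc d)
  toFin (U₁ i)  = (i ↑ˡ d) ↑ˡ (l * suc d)
  toFin (U₂ i)  = (d ↑ʳ i) ↑ˡ (l * suc d)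
  toFin (H j z) = (d + d) ↑ʳ combine j z

  classify-toFin : ∀ c → classify d l (toFin c) ≡ c
  classify-toFin (U₁ i) rewrite splitAt-↑ˡ (d + d) (i ↑ˡ d) (l * suc d) | splitAt-↑ˡ d i d = refl
  classify-toFin (U₂ i) rewrite splitAt-↑ˡ (d + d) (d ↑ʳ i) (l * suc d) | splitAt-↑ʳ d d i = refl
  classify-toFin (H j z) rewrite splitAt-↑ʳ (d + d) (l * suc d) (combine j z) =
    cong (uncurry H) (remQuot-combine j z)

  toFin-classify : ∀ x → toFin (classify d l x) ≡ x
  toFin-classify x with splitAt (d + d) x in eq
  ... | inj₂ y with remQuot {l} (suc d) y
  ...   | _ = trans (cong ((d + d) ↑ʳ_) (combine-remQuot {l} (suc d) y)) (splitAt⁻¹-↑ʳ eq)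
  toFin-classify x | inj₁ y with splitAt d y in eq′
  ... | inj₁ _ = trans (cong (_↑ˡ (l * suc d)) (splitAt⁻¹-↑ˡ eq′)) (splitAt⁻¹-↑ˡ eq)
  ... | inj₂ _ = trans (cong (_↑ˡ (l * suc d)) (splitAt⁻¹-↑ʳ eq′)) (splitAt⁻¹-↑ˡ eq)

  toFin-injective : ∀ {c c′} → toFin c ≡ toFin c′ → c ≡ c′
  toFin-injective {c} {c′} eq =
    trans (sym (classify-toFin c)) (trans (cong (classify d l) eq) (classify-toFin c′))

module _ {d l : ℕ} where

  InH : Fin l → Vtx d l → Set
  InH i (H j _) = j ≡ i
  InH _ _       = ⊥

  InH? : ∀ i → Decidable (InH i)
  InH? i (U₁ _)  = no λ ()
  InH? i (U₂ _)  = no λ ()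
  InH? i (H j _) = j ≟ i

  InH∪u : (Fin l → Fin d) → Fin l → Vtx d l → Set
  InH∪u u i (U₁ m)  = m ≡ u i
  InH∪u _ _ (U₂ _)  = ⊥
  InH∪u _ i (H j _) = j ≡ i

  InH∪u? : ∀ u i → Decidable (InH∪u u i)
  InH∪u? u i (U₁ m)  = m ≟ u i
  InH∪u? _ _ (U₂ _)  = no λ ()
  InH∪u? _ i (H j _) = j ≟ i

module _ {d l : ℕ} {u : Fin l → Fin d} {v : Fin l → Fin (suc d)} where

  VAdj-irrefl : ∀ c → ¬ VAdj u v c c
  VAdj-irrefl (H _ _) (_ , z≢z) = z≢z refl

  enter-H : ∀ {i c c′} → VAdj u v c c′ → ¬ InH i c → InH i c′ → c ≡ U₁ (u i) × c′ ≡ H i (v i)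
  enter-H {c = U₁ _}  {H _ _} (refl , refl) _   refl = refl , refl
  enter-H {c = H _ _} {H _ _} (refl , _)    ¬in refl = contradiction refl ¬in

  module _ (u-inj : Injective _≡_ _≡_ u) where

    enter-H∪u : ∀ {i c c′} → VAdj u v c c′ → ¬ InH∪u u i c → InH∪u u i c′ →
                ∃ λ j → c ≡ U₂ j × c′ ≡ U₁ (u i)
    enter-H∪u {c = U₂ j}  {U₁ _}  _          _   refl = j , refl , refl
    enter-H∪u {c = H _ _} {U₁ _}  (eq , _)   ¬in refl = contradiction (u-inj eq) ¬in
    enter-H∪u {c = U₁ _}  {H _ _} (refl , _) ¬in refl = contradiction refl ¬in
    enter-H∪u {c = H _ _} {H _ _} (refl , _) ¬in refl = contradiction refl ¬in

    VAdj-U₁-inv : ∀ {i c} → VAdj u v (U₁ (u i)) c → (∃ λ j → c ≡ U₂ j) ⊎ c ≡ H i (v i)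
    VAdj-U₁-inv {c = U₂ j}  _         = inj₁ (j , refl)
    VAdj-U₁-inv {c = H _ _} (eq , refl) with u-inj eq
    ... | refl = inj₂ refl

module TreeInG {k d l : ℕ} {u : Fin l → Fin d} (u-inj : Injective _≡_ _≡_ u) {v : Fin l → Fin (suc d)}
  {t : Fin ((d + d) + l * suc d) → Fin ((d + d) + l * suc d) → Bool} (st : TwoKST k (GAdj d l u v) t) where

  open Vertices d l
  module T = SpanningTree (TwoKST.tree st)
  open SimpleGraph t T.sym (λ x → VAdj-irrefl (classify d l x) ∘ T.subset x x) public

  uᵢ vᵢ : Fin l → Fin ((d + d) + l * suc d)
  uᵢ i = toFin (U₁ (u i))
  vᵢ i = toFin (H i (v i))

  U₁s U₂s : List (Fin ((d + d) + l * suc d))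
  U₁s = tabulate uᵢ
  U₂s = tabulate (toFin ∘ U₂)

  |U₁s|≡l : length U₁s ≡ l
  |U₁s|≡l = length-tabulate uᵢ

  |U₂s|≡d : length U₂s ≡ d
  |U₂s|≡d = length-tabulate (toFin ∘ U₂)

  Unique-U₁s : Unique U₁s
  Unique-U₁s = Uniqueₚ.tabulate⁺ (λ eq → u-inj (U₁-injective (toFin-injective eq)))
    where U₁-injective : ∀ {i j} → U₁ {d} {l} i ≡ U₁ j → i ≡ j
          U₁-injective refl = refl

  Unique-U₂s : Unique U₂s
  Unique-U₂s = Uniqueₚ.tabulate⁺ (λ eq → U₂-injective (toFin-injective eq))
    where U₂-injective : ∀ {i j} → U₂ {d} {l} i ≡ U₂ j → i ≡ j
          U₂-injective refl = refl

  Edge-toFin : ∀ {x y c c′} → classify d l x ≡ c → classify d l y ≡ c′ →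
               Edge t x y → Edge t (toFin c) (toFin c′)
  Edge-toFin {x} {y} refl refl = subst₂ (Edge t) (sym (toFin-classify x)) (sym (toFin-classify y))

  uᵢvᵢ∈T : ∀ i → Edge t (uᵢ i) (vᵢ i)
  uᵢvᵢ∈T i with Walk-crossing (InH i ∘ classify d l) (InH? i ∘ classify d l) (T.conn (uᵢ i) (vᵢ i))
                  (subst (¬_ ∘ InH i) (sym (classify-toFin (U₁ (u i)))) λ ())
                  (subst (InH i) (sym (classify-toFin (H i (v i)))) refl)
  ... | x , y , x∉H , y∈H , e with cx , cy ← enter-H (T.subset x y e) x∉H y∈H = Edge-toFin cx cy e

  uᵢ-has-U₂-neighbour : Fin d → ∀ i → ∃ λ j → Edge t (uᵢ i) (toFin (U₂ j))
  uᵢ-has-U₂-neighbour j₀ i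
    with Walk-crossing (InH∪u u i ∘ classify d l) (InH∪u? u i ∘ classify d l)
           (T.conn (toFin (U₂ j₀)) (uᵢ i))
           (subst (¬_ ∘ InH∪u u i) (sym (classify-toFin (U₂ j₀))) λ ())
           (subst (InH∪u u i) (sym (classify-toFin (U₁ (u i)))) refl)
  ... | x , y , x∉ , y∈ , e with j , cx , cy ← enter-H∪u u-inj (T.subset x y e) x∉ y∈ =
    j , Edge-sym (Edge-toFin cx cy e)

  N[uᵢ]⊆vᵢ∷U₂s : ∀ i {y} → Edge t (uᵢ i) y → y ∈ vᵢ i ∷ U₂s
  N[uᵢ]⊆vᵢ∷U₂s i {y} e
    with VAdj-U₁-inv u-inj
           (subst (λ c → VAdj u v c (classify d l y)) (classify-toFin (U₁ (u i))) (T.subset _ y e))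
  ... | inj₁ (j , cy) = there (subst (_∈ U₂s) (trans (cong toFin (sym cy)) (toFin-classify y)) (∈-tabulate⁺ j))
  ... | inj₂ cy      = here (trans (sym (toFin-classify y)) (cong toFin cy))

  deg-uᵢ : ∀ i → deg t (uᵢ i) ≡ suc (length (N[ uᵢ i ]∩ U₂s))
  deg-uᵢ i = trans (deg≡|N∩| (vᵢ∉U₂s ∷ Unique-U₂s) (N[uᵢ]⊆vᵢ∷U₂s i)) (|N∩|-∷ U₂s (uᵢvᵢ∈T i))
    where
    vᵢ∉U₂s : All (vᵢ i ≢_) U₂s
    vᵢ∉U₂s = tabulate⁺ λ j eq → case toFin-injective {H i (v i)} {U₂ j} eq of λ ()

  k≤|N[uᵢ]∩U₂s| : Fin d → ∀ i → k ≤ length (N[ uᵢ i ]∩ U₂s)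
  k≤|N[uᵢ]∩U₂s| j₀ i =
    s≤s⁻¹ (≤-trans (≰⇒> λ deg≤k → TwoKST.noMid st (uᵢ i) (2≤deg , deg≤k)) (≤-reflexive (deg-uᵢ i)))
    where
    2≤deg : 2 ≤ deg t (uᵢ i)
    2≤deg with j , e ← uᵢ-has-U₂-neighbour j₀ i =
      subst (2 ≤_) (sym (deg-uᵢ i))
            (s≤s (Unique-⊆⇒length≤ ([] ∷ []) λ { (here refl) → ∈-N⁺ (∈-tabulate⁺ j) e }))

l+[k∸1]*l≡l*k : ∀ {k} l → 1 ≤ k → l + (k ∸ 1) * l ≡ l * k
l+[k∸1]*l≡l*k {suc k} l _ = *-comm (suc k) l

proposition3 : (k d l : ℕ) → 2 ≤ k → 1 ≤ d → (k ∸ 1) * l ≡ d →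
    (u : Fin l → Fin d) → Injective _≡_ _≡_ u → (v : Fin l → Fin (suc d)) →
    ¬ ∃ (λ (T : Fin ((d + d) + l * suc d) → Fin ((d + d) + l * suc d) → Bool) →
           TwoKST k (GAdj d l u v) T)
proposition3 k (suc d) zero _ _ [k∸1]*0≡1+d _ _ _ _ =
  0≢1+n (trans (sym (*-zeroʳ (k ∸ 1))) [k∸1]*0≡1+d)
proposition3 k (suc d) l@(suc _) 2≤k _ [k∸1]*l≡1+d _ u-inj _ (_ , st) =
  T.acyclic (Dense⇒HasCycle Unique-U₁s Unique-U₂s (subst (0 <_) (sym |U₁s|≡l) (s≤s z≤n)) dense)
  where
  open TreeInG u-inj st
  open ≤-Reasoning

  dense : Dense U₁s U₂s
  dense = begin
    length U₁s + length U₂s  ≡⟨ cong₂ _+_ |U₁s|≡l |U₂s|≡d ⟩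
    l + suc d                ≡⟨ cong (l +_) [k∸1]*l≡1+d ⟨
    l + (k ∸ 1) * l          ≡⟨ l+[k∸1]*l≡l*k l (<⇒≤ 2≤k) ⟩
    l * k                    ≡⟨ cong (_* k) |U₁s|≡l ⟨
    length U₁s * k           ≤⟨ edges-≥ U₂s (tabulate⁺ (k≤|N[uᵢ]∩U₂s| Fin.zero)) ⟩
    edges U₁s U₂s            ∎
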